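{- For every $n\ge1$, the set $Q_n^{(1)}=\{\pi\in S_n: |q^{ -1}(\pi)|=1\}$ equals the set of $\pi\in S_n$ such that $\pi_n=n$ and there is no index $i$ with both $\pi_i$ and $\pi_{i+1}$ LTR maxima of $\pi$. Consequently \[|Q_n^{(1)}|=(n-1)!\sum_{i=0}^{n-1}\frac{(-1)^i}{i!},\] the number of derangements of $\{1,\dots,n-1\}$.
   Context: $S_n$ is the set of permutations of $\{1,\dots,n\}$ in one-line notation $\pi=\pi_1\cdots\pi_n$. An entry $\pi_i$ is a left-to-right (LTR) maximum if $\pi_i>\pi_j$ for all $j<i$. The map $q:S_n\to S_n$ (the algorithm Queuesort, sorting with a queue allowing bypass) is described as follows: let $m_1,\dots,m_r$ be the LTR maxima of $\pi$ from left to right; for $i=r,r-1,\dots,1$ in this order, repeatedly swap $m_i$ with the entry immediately to its right as long as such an entry exists and is smaller than $m_i$; the result is $q(\pi)$ (e.g. $q(21543)=12435$). $q^{ -1}(\pi)=\{\sigma\in S_n:q(\sigma)=\pi\}$. -}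

module Defs where

open import Data.Nat using (ℕ; zero; suc; _<_; _<ᵇ_; _!; _∸_)
open import Data.Nat.Properties using (_!≢0)
open import Data.Bool using (if_then_else_)
open import Data.List using (List; []; _∷_; length; lookup; applyUpTo)
open import Data.Fin using (Fin; toℕ)
open import Data.Product using (Σ; _×_; ∃-syntax)
open import Data.Integer as ℤ using (ℤ; +_)
open import Data.Rational as ℚ using (ℚ)
open import Relation.Binary.PropositionalEquality using (_≡_)
open import Relation.Nullary using (¬_)
open import Data.List.Relation.Binary.Permutation.Propositional using (_↭_)

-- A permutation in S_n, in one-line notation, is a list of naturals that is
-- a rearrangement of [1, 2, ..., n].
oneTo : ℕ → List ℕ
oneTo n = applyUpTo suc n

InS : ℕ → List ℕ → Set
InS n π = π ↭ oneTo n

bubble : ℕ → List ℕ → List ℕ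
bubble x [] = x ∷ []
bubble x (y ∷ ys) = if y <ᵇ x then y ∷ bubble x ys else x ∷ y ∷ ys

-- qaux cur π: cur is the maximum of the entries to the left of π.
-- An entry y > cur is an LTR maximum; the LTR maxima to its right are
-- processed first (order r, r-1, ..., 1), then y is bubbled to the right.
qaux : ℕ → List ℕ → List ℕ
qaux cur [] = []
qaux cur (y ∷ ys) = if cur <ᵇ y then bubble y (qaux y ys) else y ∷ qaux cur ys

-- Queuesort (entries are ≥ 1, so the first entry is always an LTR maximum).
q : List ℕ → List ℕ
q π = qaux 0 π

UniquePreimage : ℕ → List ℕ → Set
UniquePreimage n π =
  Σ (List ℕ) λ σ → (InS n σ × q σ ≡ π) × (∀ τ → InS n τ → q τ ≡ π → τ ≡ σ)

InQ1 : ℕ → List ℕ → Set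
InQ1 n π = InS n π × UniquePreimage n π

IsLTRMax : (π : List ℕ) → Fin (length π) → Set
IsLTRMax π i = ∀ (j : Fin (length π)) → toℕ j < toℕ i → lookup π j < lookup π i

NoAdjacentLTRMax : List ℕ → Set
NoAdjacentLTRMax π = ¬ (∃[ i ] ∃[ j ] (toℕ j ≡ suc (toℕ i) × IsLTRMax π i × IsLTRMax π j))

sumQ : ℕ → (ℕ → ℚ) → ℚ
sumQ zero f = ℚ.0ℚ
sumQ (suc m) f = sumQ m f ℚ.+ f m

derangementFormula : ℕ → ℚ
derangementFormula n =
  ((+ ((n ∸ 1) !)) ℚ./ 1) ℚ.* sumQ n (λ i → ((ℤ.-1ℤ ℤ.^ i) ℚ./ (i !)) {{i !≢0}})

-- Queuesort ends every permutation of S_n with n, and q (n ∷ ρ) = ρ ∷ʳ n, so each π = ρ ∷ʳ n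
-- has the canonical preimage n ∷ ρ.  A preimage starting with y < n has y bubbled up to just
-- before the first larger entry, which creates adjacent left-to-right maxima in the image.
-- Conversely, if a and b are adjacent left-to-right maxima of π = xs ++ a ∷ b ∷ ys, then moving a
-- to the front and n back behind xs gives a second preimage.
--
-- So Q_n^(1) is in bijection with the arrangements ρ of 1, …, n - 1 in which every left-to-right
-- maximum is followed by a smaller entry.  The least entry x of such an arrangement either sits
-- right after another entry and can simply be deleted, or it separates a maximum v from a rise (or
-- the end), and then v and x can be deleted together.  With k + 1 entries this gives
-- a (k + 1) = k (a k + a (k - 1)), the recurrence of the derangement numbers.

module Submission where

open import Defs
open import Data.Nat using (ℕ; _≤_)
open import Data.List using (List; length; last)
open import Data.Maybe using (just)
open import Data.Product using (_×_; Σ)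
open import Function.Bundles using (_⇔_)
open import Relation.Binary.PropositionalEquality using (_≡_)
open import Data.List.Relation.Unary.Unique.Propositional using (Unique)
open import Data.List.Membership.Propositional using (_∈_)
open import Data.Integer using (+_)
open import Data.Rational using (_/_)

open import Data.Nat using (NonZero; _!; zero; suc; pred; _+_; _*_; _<_; z<s; s<s; _<ᵇ_; _≡ᵇ_; _⊔_; z≤n; s≤s; _<?_; _≟_)
open import Data.Nat.Properties
open import Data.Bool using (true; false; if_then_else_)
open import Data.Empty using (⊥)
open import Data.Unit using (⊤; tt)
open import Data.Fin using (Fin; toℕ) renaming (zero to fzero; suc to fsuc)
open import Data.List using ([]; _∷_; _++_; _∷ʳ_; lookup; foldl; map; concatMap; initLast; _∷ʳ′_)
open import Data.List.Properties using (∷ʳ-injectiveˡ; ∷-injectiveˡ; ∷-injectiveʳ; ++-assoc; ++-identityʳ; length-map; length-++; length-++-sucʳ; map-∘; map-id; length-applyUpTo; applyUpTo-∷ʳ)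
open import Data.List.Relation.Unary.All as All using (All; []; _∷_)
open import Data.List.Relation.Unary.All.Properties as Allₚ using (applyUpTo⁺₁; applyUpTo⁺₂; ++⁻ʳ)
open import Data.List.Relation.Unary.Any as Any using (Any; here; there)
open import Data.List.Relation.Unary.AllPairs as AllPairs using (AllPairs; []; _∷_)
import Data.List.Relation.Unary.AllPairs.Properties as AllPairsₚ
import Data.List.Relation.Unary.Unique.Propositional.Properties as Uniqueₚ
open import Data.List.Membership.Propositional using (_∉_; lose; find)
open import Data.List.Membership.Propositional.Properties using (∈-∃++; ∈-++⁺ʳ; ∈-applyUpTo⁺; ∈-lookup; ∈-map⁺; ∈-map⁻; ∈-concatMap⁺; ∈-concatMap⁻; ∈-++⁻; ∈-++⁺ˡ)
open import Data.List.Relation.Binary.Permutation.Propositional using (_↭_; ↭-sym; ↭-trans; ↭-refl; ↭-reflexive; prep; swap; ↭⇒↭ₛ)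
open import Data.List.Relation.Binary.Permutation.Propositional.Properties using (All-resp-↭; Any-resp-↭; ∈-resp-↭; shift; ∷↭∷ʳ; ++⁺ˡ; drop-∷; drop-mid; ↭-empty-inv; ↭-length; ++⁺ʳ)
open import Data.Integer as ℤ using (ℤ; 1ℤ; -1ℤ)
import Data.Integer.Properties as ℤP
open import Data.Integer.Solver using (module +-*-Solver)
open import Data.Rational as ℚ using (ℚ; toℚᵘ)
import Data.Rational.Properties as ℚP
open import Data.Rational.Unnormalised as ℚᵘ using (mkℚᵘ; *≡*; _≃_)
import Data.Rational.Unnormalised.Properties as ℚᵘP
open import Data.Product using (_,_; proj₁; proj₂; ∃-syntax; map₂)
open import Data.Sum using (_⊎_; inj₁; inj₂)
open import Function.Base using (_∘_; id)
open import Function.Bundles using (mk⇔; Equivalence)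
open import Relation.Binary.PropositionalEquality as ≡ using (refl; sym; trans; cong; cong₂; subst; _≢_; ≢-sym; module ≡-Reasoning)
open import Relation.Nullary using (¬_; Dec; yes; no; contradiction; _×-dec_)
open import Data.List.Relation.Binary.Permutation.Setoid.Properties (≡.setoid ℕ) using (Unique-resp-↭)

<ᵇ≡true : ∀ {m n} → m < n → (m <ᵇ n) ≡ true
<ᵇ≡true {m} {n} m<n with m <ᵇ n | <⇒<ᵇ m<n
... | true | _ = refl
... | false | ()

<ᵇ≡false : ∀ {m n} → ¬ m < n → (m <ᵇ n) ≡ false
<ᵇ≡false {m} {n} m≮n with m <ᵇ n | <ᵇ⇒< m n
... | false | _ = refl
... | true | m<n = contradiction (m<n _) m≮n

≡ᵇ-refl : ∀ m → (m ≡ᵇ m) ≡ true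
≡ᵇ-refl m with m ≡ᵇ m | ≡⇒≡ᵇ m m refl
... | true | _ = refl
... | false | ()

≢⇒≡ᵇ≡false : ∀ {m n} → m ≢ n → (m ≡ᵇ n) ≡ false
≢⇒≡ᵇ≡false {m} {n} m≢n with m ≡ᵇ n | ≡ᵇ⇒≡ m n
... | false | _ = refl
... | true | m≡n = contradiction (m≡n _) m≢n

unique-resp-↭ : ∀ {xs ys : List ℕ} → xs ↭ ys → Unique xs → Unique ys
unique-resp-↭ p = Unique-resp-↭ (↭⇒↭ₛ p)

unique-++-∷⇒∉ : ∀ (xs : List ℕ) {x ys} → Unique (xs ++ x ∷ ys) → All (_≢ x) xs × All (x ≢_) ys
unique-++-∷⇒∉ [] (x∉ys ∷ _) = [] , x∉ys
unique-++-∷⇒∉ (y ∷ xs) (y∉ ∷ u) with unique-++-∷⇒∉ xs u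
... | x∉xs , x∉ys = All.lookup y∉ (∈-++⁺ʳ xs (here refl)) ∷ x∉xs , x∉ys

last-∷ʳ : ∀ (xs : List ℕ) x → last (xs ∷ʳ x) ≡ just x
last-∷ʳ [] x = refl
last-∷ʳ (y ∷ []) x = refl
last-∷ʳ (y ∷ z ∷ zs) x = last-∷ʳ (z ∷ zs) x

last-∷ : ∀ y (xs : List ℕ) {x} → last xs ≡ just x → last (y ∷ xs) ≡ just x
last-∷ y (z ∷ zs) e = e

last-++ : ∀ (xs : List ℕ) y ys {x} → last (xs ++ y ∷ ys) ≡ just x → last (y ∷ ys) ≡ just x
last-++ [] y ys e = e
last-++ (_ ∷ []) y ys e = e
last-++ (_ ∷ x′ ∷ xs) y ys e = last-++ (x′ ∷ xs) y ys e

last≡just⇒∷ʳ : ∀ (xs : List ℕ) {x} → last xs ≡ just x → ∃[ ys ] xs ≡ ys ∷ʳ x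
last≡just⇒∷ʳ (y ∷ []) refl = [] , refl
last≡just⇒∷ʳ (y ∷ z ∷ zs) e with last≡just⇒∷ʳ (z ∷ zs) e
... | ys , eq = y ∷ ys , cong (y ∷_) eq

oneTo-sorted : ∀ n → AllPairs _<_ (oneTo n)
oneTo-sorted n = AllPairsₚ.applyUpTo⁺₁ suc n (λ i<j _ → s≤s i<j)

sorted⇒unique : ∀ {xs : List ℕ} → AllPairs _<_ xs → Unique xs
sorted⇒unique = AllPairs.map <⇒≢

module _ {n : ℕ} {π : List ℕ} (π∈Sₙ : InS n π) where

  InS⇒positive : All (0 <_) π
  InS⇒positive = All-resp-↭ (↭-sym π∈Sₙ) (applyUpTo⁺₂ suc n (λ _ → s≤s z≤n))

  InS⇒≤ : All (_≤ n) π
  InS⇒≤ = All-resp-↭ (↭-sym π∈Sₙ) (applyUpTo⁺₁ suc n (λ i<n → i<n))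

  InS⇒unique : Unique π
  InS⇒unique = unique-resp-↭ (↭-sym π∈Sₙ) (sorted⇒unique (oneTo-sorted n))

  InS⇒∋max : 1 ≤ n → n ∈ π
  InS⇒∋max (s≤s _) = ∈-resp-↭ (↭-sym π∈Sₙ) (∈-applyUpTo⁺ suc ≤-refl)

InS-split-max : ∀ {n} xs {ys} → InS n (xs ++ n ∷ ys) → All (_< n) xs × All (_< n) ys
InS-split-max {n} xs {ys} p with unique-++-∷⇒∉ xs (InS⇒unique p) | Allₚ.++⁻ xs (InS⇒≤ p)
... | ≢xs , ≢ys | ≤xs , _ ∷ ≤ys =
  All.zipWith (λ (x≤n , x≢n) → ≤∧≢⇒< x≤n x≢n) (≤xs , ≢xs) ,
  All.zipWith (λ (x≤n , n≢x) → ≤∧≢⇒< x≤n (≢-sym n≢x)) (≤ys , ≢ys)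

-- Queuesort

bubble-< : ∀ {x y} ys → y < x → bubble x (y ∷ ys) ≡ y ∷ bubble x ys
bubble-< ys y<x rewrite <ᵇ≡true y<x = refl

bubble-≮ : ∀ {x y} ys → ¬ y < x → bubble x (y ∷ ys) ≡ x ∷ y ∷ ys
bubble-≮ ys y≮x rewrite <ᵇ≡false y≮x = refl

qaux-< : ∀ {c y} ys → c < y → qaux c (y ∷ ys) ≡ bubble y (qaux y ys)
qaux-< ys c<y rewrite <ᵇ≡true c<y = refl

qaux-≮ : ∀ {c y} ys → ¬ c < y → qaux c (y ∷ ys) ≡ y ∷ qaux c ys
qaux-≮ ys c≮y rewrite <ᵇ≡false c≮y = refl

bubble-++ : ∀ {x} (ys : List ℕ) zs → All (_< x) ys → bubble x (ys ++ zs) ≡ ys ++ bubble x zs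
bubble-++ [] zs [] = refl
bubble-++ (y ∷ ys) zs (y<x ∷ ys<x) = trans (bubble-< (ys ++ zs) y<x) (cong (y ∷_) (bubble-++ ys zs ys<x))

bubble-below : ∀ {x} (ys : List ℕ) → All (_< x) ys → bubble x ys ≡ ys ∷ʳ x
bubble-below [] [] = refl
bubble-below (y ∷ ys) (y<x ∷ ys<x) = trans (bubble-< ys y<x) (cong (y ∷_) (bubble-below ys ys<x))

qaux-++ : ∀ {c} (ys : List ℕ) zs → All (_≤ c) ys → qaux c (ys ++ zs) ≡ ys ++ qaux c zs
qaux-++ [] zs [] = refl
qaux-++ (y ∷ ys) zs (y≤c ∷ ys≤c) = trans (qaux-≮ (ys ++ zs) (≤⇒≯ y≤c)) (cong (y ∷_) (qaux-++ ys zs ys≤c))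

qaux-below : ∀ {c} (ys : List ℕ) → All (_≤ c) ys → qaux c ys ≡ ys
qaux-below [] [] = refl
qaux-below (y ∷ ys) (y≤c ∷ ys≤c) = trans (qaux-≮ ys (≤⇒≯ y≤c)) (cong (y ∷_) (qaux-below ys ys≤c))

qaux-max-head : ∀ {c n} ys → c < n → All (_< n) ys → qaux c (n ∷ ys) ≡ ys ∷ʳ n
qaux-max-head {c} {n} ys c<n ys<n = begin
  qaux c (n ∷ ys)       ≡⟨ qaux-< ys c<n ⟩
  bubble n (qaux n ys)  ≡⟨ cong (bubble n) (qaux-below ys (All.map <⇒≤ ys<n)) ⟩
  bubble n ys           ≡⟨ bubble-below ys ys<n ⟩
  ys ∷ʳ n               ∎
  where open ≡-Reasoning

bubble-↭ : ∀ x (ys : List ℕ) → bubble x ys ↭ x ∷ ys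
bubble-↭ x [] = ↭-refl
bubble-↭ x (y ∷ ys) with y <ᵇ x
... | true = ↭-trans (prep y (bubble-↭ x ys)) (swap y x ↭-refl)
... | false = ↭-refl

qaux-↭ : ∀ c (ys : List ℕ) → qaux c ys ↭ ys
qaux-↭ c [] = ↭-refl
qaux-↭ c (y ∷ ys) with c <ᵇ y
... | true = ↭-trans (bubble-↭ y (qaux y ys)) (prep y (qaux-↭ y ys))
... | false = prep y (qaux-↭ c ys)

last-bubble : ∀ {n} x (ys : List ℕ) → x < n → last ys ≡ just n → last (bubble x ys) ≡ just n
last-bubble x (y ∷ ys) x<n e with y <? x
last-bubble x (y ∷ []) x<n refl | yes n<x = contradiction n<x (<⇒≯ x<n)
last-bubble x (y ∷ z ∷ zs) x<n e | yes y<x =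
  trans (cong last (bubble-< (z ∷ zs) y<x)) (last-∷ y (bubble x (z ∷ zs)) (last-bubble x (z ∷ zs) x<n e))
... | no y≮x = trans (cong last (bubble-≮ ys y≮x)) e

last-qaux : ∀ {c n} xs {ys} → c < n → All (_< n) xs → All (_< n) ys → last (qaux c (xs ++ n ∷ ys)) ≡ just n
last-qaux {c} {n} [] {ys} c<n [] ys<n = trans (cong last (qaux-max-head ys c<n ys<n)) (last-∷ʳ ys n)
last-qaux {c} {n} (x ∷ xs) {ys} c<n (x<n ∷ xs<n) ys<n with c <? x
... | yes c<x = trans (cong last (qaux-< (xs ++ n ∷ ys) c<x))
                  (last-bubble x (qaux x (xs ++ n ∷ ys)) x<n (last-qaux xs x<n xs<n ys<n))
... | no c≮x = trans (cong last (qaux-≮ (xs ++ n ∷ ys) c≮x))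
                 (last-∷ x (qaux c (xs ++ n ∷ ys)) (last-qaux xs c<n xs<n ys<n))

-- Adjacent left-to-right maxima

-- Two consecutive entries of π that are left-to-right maxima of c ∷ π.
AdjacentMaxima : ℕ → List ℕ → Set
AdjacentMaxima c [] = ⊥
AdjacentMaxima c (y ∷ []) = ⊥
AdjacentMaxima c (y ∷ z ∷ zs) = (c < y × y < z) ⊎ AdjacentMaxima (c ⊔ y) (z ∷ zs)

adjacentMaxima-intro : ∀ c (xs : List ℕ) {a b} ys → All (_< a) xs → c < a → a < b →
                       AdjacentMaxima c (xs ++ a ∷ b ∷ ys)
adjacentMaxima-intro c [] ys [] c<a a<b = inj₁ (c<a , a<b)
adjacentMaxima-intro c (x ∷ []) ys (x<a ∷ []) c<a a<b =
  inj₂ (adjacentMaxima-intro (c ⊔ x) [] ys [] (⊔-lub c<a x<a) a<b)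
adjacentMaxima-intro c (x ∷ x′ ∷ xs) ys (x<a ∷ xs<a) c<a a<b =
  inj₂ (adjacentMaxima-intro (c ⊔ x) (x′ ∷ xs) ys xs<a (⊔-lub c<a x<a) a<b)

adjacentMaxima-split : ∀ c (π : List ℕ) → AdjacentMaxima c π →
  ∃[ xs ] ∃[ a ] ∃[ b ] ∃[ ys ] π ≡ xs ++ a ∷ b ∷ ys × All (_< a) xs × c < a × a < b
adjacentMaxima-split c (y ∷ z ∷ zs) (inj₁ (c<y , y<z)) = [] , y , z , zs , refl , [] , c<y , y<z
adjacentMaxima-split c (y ∷ z ∷ zs) (inj₂ adj) with adjacentMaxima-split (c ⊔ y) (z ∷ zs) adj
... | xs , a , b , ys , eq , xs<a , c⊔y<a , a<b =
  y ∷ xs , a , b , ys , cong (y ∷_) eq , m⊔n<o⇒n<o c y c⊔y<a ∷ xs<a , m⊔n<o⇒m<o c y c⊔y<a , a<b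

LTRMaxAbove : ℕ → (π : List ℕ) → Fin (length π) → Set
LTRMaxAbove c π i = c < lookup π i × IsLTRMax π i

ltrMaxAbove-tail : ∀ {c y} ys (i : Fin (length ys)) → LTRMaxAbove c (y ∷ ys) (fsuc i) → LTRMaxAbove (c ⊔ y) ys i
ltrMaxAbove-tail ys i (c<v , max) = ⊔-lub c<v (max fzero z<s) , λ k k<i → max (fsuc k) (s<s k<i)

ltrMaxAbove-cons : ∀ {c y} ys (i : Fin (length ys)) → LTRMaxAbove (c ⊔ y) ys i → LTRMaxAbove c (y ∷ ys) (fsuc i)
ltrMaxAbove-cons {c} {y} ys i (c⊔y<v , max) = m⊔n<o⇒m<o c y c⊔y<v , λ
  { fzero _ → m⊔n<o⇒n<o c y c⊔y<v
  ; (fsuc k) (s≤s k<i) → max k k<i }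

adjacentLTRMax⇒adjacentMaxima : ∀ c (π : List ℕ) (i j : Fin (length π)) → toℕ j ≡ suc (toℕ i) →
                                LTRMaxAbove c π i → LTRMaxAbove c π j → AdjacentMaxima c π
adjacentLTRMax⇒adjacentMaxima c (y ∷ z ∷ zs) fzero (fsuc fzero) refl (c<y , _) (_ , max) =
  inj₁ (c<y , max fzero z<s)
adjacentLTRMax⇒adjacentMaxima c (y ∷ z ∷ zs) (fsuc i) (fsuc j) e mi mj =
  inj₂ (adjacentLTRMax⇒adjacentMaxima (c ⊔ y) (z ∷ zs) i j (suc-injective e)
         (ltrMaxAbove-tail (z ∷ zs) i mi) (ltrMaxAbove-tail (z ∷ zs) j mj))
adjacentLTRMax⇒adjacentMaxima c (y ∷ []) (fsuc ()) _ _ _ _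
adjacentLTRMax⇒adjacentMaxima c (y ∷ []) fzero (fsuc ()) _ _ _
adjacentLTRMax⇒adjacentMaxima c (y ∷ z ∷ zs) fzero (fsuc (fsuc j)) () _ _

adjacentMaxima⇒adjacentLTRMax : ∀ c (π : List ℕ) → AdjacentMaxima c π →
  ∃[ i ] ∃[ j ] (toℕ j ≡ suc (toℕ i) × LTRMaxAbove c π i × LTRMaxAbove c π j)
adjacentMaxima⇒adjacentLTRMax c (y ∷ z ∷ zs) (inj₁ (c<y , y<z)) =
  fzero , fsuc fzero , refl , (c<y , λ _ ()) , (<-trans c<y y<z , λ { fzero _ → y<z ; (fsuc _) (s≤s ()) })
adjacentMaxima⇒adjacentLTRMax c (y ∷ z ∷ zs) (inj₂ adj) with adjacentMaxima⇒adjacentLTRMax (c ⊔ y) (z ∷ zs) adj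
... | i , j , e , mi , mj = fsuc i , fsuc j , cong suc e , ltrMaxAbove-cons (z ∷ zs) i mi , ltrMaxAbove-cons (z ∷ zs) j mj

noAdjacentLTRMax⇔ : ∀ (π : List ℕ) → All (0 <_) π → NoAdjacentLTRMax π ⇔ (¬ AdjacentMaxima 0 π)
noAdjacentLTRMax⇔ π π>0 = mk⇔ from-LTR to-LTR
  where
  from-LTR : NoAdjacentLTRMax π → ¬ AdjacentMaxima 0 π
  from-LTR noLTR adj with adjacentMaxima⇒adjacentLTRMax 0 π adj
  ... | i , j , e , mi , mj = noLTR (i , j , e , proj₂ mi , proj₂ mj)
  to-LTR : ¬ AdjacentMaxima 0 π → NoAdjacentLTRMax π
  to-LTR noAdj (i , j , e , mi , mj) =
    noAdj (adjacentLTRMax⇒adjacentMaxima 0 π i j e (positive i , mi) (positive j , mj))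
    where
    positive : ∀ k → 0 < lookup π k
    positive k = All.lookup π>0 (∈-lookup k)

-- Preimages under queuesort

split-first-above : ∀ y (zs : List ℕ) → All (y ≢_) zs → Any (y <_) zs →
  ∃[ xs ] ∃[ z ] ∃[ ws ] zs ≡ xs ++ z ∷ ws × All (_< y) xs × y < z
split-first-above y (z ∷ zs) (y≢z ∷ y∉zs) y<some with y <? z | y<some
... | yes y<z | _ = [] , z , zs , refl , [] , y<z
... | no y≮z | here y<z = contradiction y<z y≮z
... | no y≮z | there y<some′ with split-first-above y zs y∉zs y<some′
...   | xs , z′ , ws , eq , xs<y , y<z′ =
  z ∷ xs , z′ , ws , cong (z ∷_) eq , ≤∧≢⇒< (≮⇒≥ y≮z) (≢-sym y≢z) ∷ xs<y , y<z′

qaux-adjacentMaxima : ∀ {c y} ys → c < y → All (y ≢_) ys → Any (y <_) ys → AdjacentMaxima c (qaux c (y ∷ ys))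
qaux-adjacentMaxima {c} {y} ys c<y y∉ys y<some
  with split-first-above y (qaux y ys) (All-resp-↭ (↭-sym (qaux-↭ y ys)) y∉ys)
                                        (Any-resp-↭ (↭-sym (qaux-↭ y ys)) y<some)
... | xs , z , ws , eq , xs<y , y<z = subst (AdjacentMaxima c) (sym qaux≡) (adjacentMaxima-intro c xs ws xs<y c<y y<z)
  where
  open ≡-Reasoning
  qaux≡ : qaux c (y ∷ ys) ≡ xs ++ y ∷ z ∷ ws
  qaux≡ = begin
    qaux c (y ∷ ys)          ≡⟨ qaux-< ys c<y ⟩
    bubble y (qaux y ys)     ≡⟨ cong (bubble y) eq ⟩
    bubble y (xs ++ z ∷ ws)  ≡⟨ bubble-++ xs (z ∷ ws) xs<y ⟩
    xs ++ bubble y (z ∷ ws)  ≡⟨ cong (xs ++_) (bubble-≮ ws (<⇒≯ y<z)) ⟩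
    xs ++ y ∷ z ∷ ws         ∎

q-second-preimage : ∀ {a b n} xs {ys zs} → 0 < a → a < b → a < n → All (_< a) xs → All (_< n) zs →
                    b ∷ ys ≡ zs ∷ʳ n → q (a ∷ xs ++ n ∷ zs) ≡ xs ++ a ∷ b ∷ ys
q-second-preimage {a} {b} {n} xs {ys} {zs} 0<a a<b a<n xs<a zs<n b∷ys≡ = begin
  qaux 0 (a ∷ xs ++ n ∷ zs)         ≡⟨ qaux-< (xs ++ n ∷ zs) 0<a ⟩
  bubble a (qaux a (xs ++ n ∷ zs))  ≡⟨ cong (bubble a) (qaux-++ xs (n ∷ zs) (All.map <⇒≤ xs<a)) ⟩
  bubble a (xs ++ qaux a (n ∷ zs))  ≡⟨ cong (λ ws → bubble a (xs ++ ws)) (qaux-max-head zs a<n zs<n) ⟩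
  bubble a (xs ++ zs ∷ʳ n)          ≡⟨ cong (λ ws → bubble a (xs ++ ws)) (sym b∷ys≡) ⟩
  bubble a (xs ++ b ∷ ys)           ≡⟨ bubble-++ xs (b ∷ ys) xs<a ⟩
  xs ++ bubble a (b ∷ ys)           ≡⟨ cong (xs ++_) (bubble-≮ ys (<⇒≯ a<b)) ⟩
  xs ++ a ∷ b ∷ ys                  ∎
  where open ≡-Reasoning

module _ {n : ℕ} (1≤n : 1 ≤ n) where

  canonical-preimage : ∀ {ρ} → InS n (ρ ∷ʳ n) → InS n (n ∷ ρ) × q (n ∷ ρ) ≡ ρ ∷ʳ n
  canonical-preimage {ρ} ρn∈Sₙ = ↭-trans (∷↭∷ʳ n ρ) ρn∈Sₙ , qaux-max-head ρ 1≤n (proj₁ (InS-split-max ρ ρn∈Sₙ))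

  q-last : ∀ {σ} → InS n σ → last (q σ) ≡ just n
  q-last σ∈Sₙ with ∈-∃++ (InS⇒∋max σ∈Sₙ 1≤n)
  ... | xs , ys , refl with InS-split-max xs σ∈Sₙ
  ... | xs<n , ys<n = last-qaux xs 1≤n xs<n ys<n

  preimage≡canonical : ∀ {ρ} τ → ¬ AdjacentMaxima 0 (ρ ∷ʳ n) → InS n τ → q τ ≡ ρ ∷ʳ n → τ ≡ n ∷ ρ
  preimage≡canonical [] _ τ∈Sₙ _ with InS⇒∋max τ∈Sₙ 1≤n
  ... | ()
  preimage≡canonical {ρ} (y ∷ ys) noAdj τ∈Sₙ qτ≡ with y ≟ n
  ... | yes refl = cong (n ∷_) (∷ʳ-injectiveˡ ys ρ (trans (sym (qaux-max-head ys 1≤n ys<n)) qτ≡))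
    where
    ys<n : All (_< n) ys
    ys<n = proj₂ (InS-split-max [] τ∈Sₙ)
  ... | no y≢n = contradiction (subst (AdjacentMaxima 0) qτ≡ (qaux-adjacentMaxima ys 0<y y∉ys y<some)) noAdj
    where
    0<y : 0 < y
    0<y = All.head (InS⇒positive τ∈Sₙ)
    y<n : y < n
    y<n = ≤∧≢⇒< (All.head (InS⇒≤ τ∈Sₙ)) y≢n
    y∉ys : All (y ≢_) ys
    y∉ys = AllPairs.head (InS⇒unique τ∈Sₙ)
    y<some : Any (y <_) ys
    y<some with InS⇒∋max τ∈Sₙ 1≤n
    ... | here n≡y = contradiction (sym n≡y) y≢n
    ... | there n∈ys = Any.map (λ { refl → y<n }) n∈ys

  noAdjacentMaxima⇒uniquePreimage : ∀ {π} → InS n π → last π ≡ just n → ¬ AdjacentMaxima 0 π → UniquePreimage n π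
  noAdjacentMaxima⇒uniquePreimage {π} π∈Sₙ last≡n noAdj with last≡just⇒∷ʳ π last≡n
  ... | ρ , refl = n ∷ ρ , canonical-preimage π∈Sₙ , λ τ τ∈Sₙ qτ≡ → preimage≡canonical τ noAdj τ∈Sₙ qτ≡

  uniquePreimage⇒noAdjacentMaxima : ∀ {π} → InS n π → UniquePreimage n π → ¬ AdjacentMaxima 0 π
  uniquePreimage⇒noAdjacentMaxima {π} π∈Sₙ (σ , (σ∈Sₙ , qσ≡π) , unique) adj
    with adjacentMaxima-split 0 π adj
  ... | xs , a , b , ys , refl , xs<a , 0<a , a<b
    with last≡just⇒∷ʳ (b ∷ ys) (last-++ xs a (b ∷ ys) (subst (λ l → last l ≡ just n) qσ≡π (q-last σ∈Sₙ)))
  ... | zs , b∷ys≡ = <-irrefl a≡n a<n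
    where
    ρ : List ℕ
    ρ = xs ++ a ∷ zs
    π≡ρn : xs ++ a ∷ b ∷ ys ≡ ρ ∷ʳ n
    π≡ρn = trans (cong (λ ws → xs ++ a ∷ ws) b∷ys≡) (sym (++-assoc xs (a ∷ zs) (n ∷ [])))
    a∷zs<n : All (_< n) (a ∷ zs)
    a∷zs<n = ++⁻ʳ xs (proj₁ (InS-split-max ρ (subst (InS n) π≡ρn π∈Sₙ)))
    a<n : a < n
    a<n = All.head a∷zs<n
    τ₁∈Sₙ : InS n (a ∷ xs ++ n ∷ zs)
    τ₁∈Sₙ = ↭-trans (↭-sym (shift a xs (n ∷ zs)))
              (↭-trans (++⁺ˡ xs (prep a (∷↭∷ʳ n zs))) (subst (λ ws → InS n (xs ++ a ∷ ws)) b∷ys≡ π∈Sₙ))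
    τ₁≡σ : a ∷ xs ++ n ∷ zs ≡ σ
    τ₁≡σ = unique _ τ₁∈Sₙ (q-second-preimage xs 0<a a<b a<n xs<a (All.tail a∷zs<n) b∷ys≡)
    τ₀≡σ : n ∷ ρ ≡ σ
    τ₀≡σ = let (τ₀∈Sₙ , qτ₀) = canonical-preimage (subst (InS n) π≡ρn π∈Sₙ) in
           unique _ τ₀∈Sₙ (trans qτ₀ (sym π≡ρn))
    a≡n : a ≡ n
    a≡n = ∷-injectiveˡ (trans τ₁≡σ (sym τ₀≡σ))

  InQ1⇔ : ∀ π → InQ1 n π ⇔ (InS n π × last π ≡ just n × ¬ AdjacentMaxima 0 π)
  InQ1⇔ π = mk⇔
    (λ (π∈Sₙ , unique@(σ , (σ∈Sₙ , qσ≡π) , _)) →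
       π∈Sₙ , subst (λ l → last l ≡ just n) qσ≡π (q-last σ∈Sₙ) , uniquePreimage⇒noAdjacentMaxima π∈Sₙ unique)
    (λ (π∈Sₙ , last≡n , noAdj) → π∈Sₙ , noAdjacentMaxima⇒uniquePreimage π∈Sₙ last≡n noAdj)

-- Arrangements whose maxima descend

StartsAbove : ℕ → List ℕ → Set
StartsAbove y [] = ⊤
StartsAbove y (z ∷ _) = y < z

startsAbove? : ∀ y ys → Dec (StartsAbove y ys)
startsAbove? y [] = yes tt
startsAbove? y (z ∷ _) = y <? z

-- No left-to-right maximum of c ∷ ρ inside ρ is followed by a larger entry or by the end of ρ.
-- For ρ below n this says that ρ ∷ʳ n has no adjacent left-to-right maxima.
MaximaDescend : ℕ → List ℕ → Set
MaximaDescend c [] = ⊤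
MaximaDescend c (y ∷ ys) = ¬ (c < y × StartsAbove y ys) × MaximaDescend (c ⊔ y) ys

maximaDescend⇒¬adjacentMaxima : ∀ c (ρ : List ℕ) {n} → MaximaDescend c ρ → ¬ AdjacentMaxima c (ρ ∷ʳ n)
maximaDescend⇒¬adjacentMaxima c (y ∷ []) (¬rise , _) (inj₁ (c<y , _)) = ¬rise (c<y , tt)
maximaDescend⇒¬adjacentMaxima c (y ∷ w ∷ ws) (¬rise , _) (inj₁ (c<y , y<w)) = ¬rise (c<y , y<w)
maximaDescend⇒¬adjacentMaxima c (y ∷ w ∷ ws) (_ , desc) (inj₂ adj) =
  maximaDescend⇒¬adjacentMaxima (c ⊔ y) (w ∷ ws) desc adj

¬adjacentMaxima⇒maximaDescend : ∀ c (ρ : List ℕ) {n} → All (_< n) ρ → ¬ AdjacentMaxima c (ρ ∷ʳ n) → MaximaDescend c ρ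
¬adjacentMaxima⇒maximaDescend c [] _ _ = tt
¬adjacentMaxima⇒maximaDescend c (y ∷ []) (y<n ∷ []) noAdj = (λ (c<y , _) → noAdj (inj₁ (c<y , y<n))) , tt
¬adjacentMaxima⇒maximaDescend c (y ∷ w ∷ ws) (_ ∷ ρ<n) noAdj =
  (λ (c<y , y<w) → noAdj (inj₁ (c<y , y<w))) ,
  ¬adjacentMaxima⇒maximaDescend (c ⊔ y) (w ∷ ws) ρ<n (λ adj → noAdj (inj₂ adj))

startsAbove-++ : ∀ {a} (xs : List ℕ) {y ys zs} → StartsAbove a (xs ++ y ∷ ys) → StartsAbove a (xs ++ y ∷ zs)
startsAbove-++ [] h = h
startsAbove-++ (_ ∷ _) h = h

≤-foldl-⊔ : ∀ c (xs : List ℕ) → c ≤ foldl _⊔_ c xs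
≤-foldl-⊔ c [] = ≤-refl
≤-foldl-⊔ c (x ∷ xs) = ≤-trans (m≤m⊔n c x) (≤-foldl-⊔ (c ⊔ x) xs)

foldl-⊔<⇒All< : ∀ c (xs : List ℕ) {y} → foldl _⊔_ c xs < y → All (_< y) xs
foldl-⊔<⇒All< c [] _ = []
foldl-⊔<⇒All< c (x ∷ xs) h = ≤-<-trans (m≤n⊔m c x) (≤-<-trans (≤-foldl-⊔ (c ⊔ x) xs) h) ∷ foldl-⊔<⇒All< (c ⊔ x) xs h

maximaDescend-lower : ∀ {c y} (ys : List ℕ) → MaximaDescend y ys → StartsAbove y ys → c ≤ y → MaximaDescend c ys
maximaDescend-lower [] _ _ _ = tt
maximaDescend-lower {c} {y} (z ∷ zs) (¬rise , desc) y<z c≤y =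
  (λ (_ , rise) → ¬rise (y<z , rise)) ,
  subst (λ d → MaximaDescend d zs) (trans (m≤n⇒m⊔n≡n (<⇒≤ y<z)) (sym (m≤n⇒m⊔n≡n (≤-trans c≤y (<⇒≤ y<z))))) desc

-- foldl _⊔_ c xs < y says that y is a left-to-right maximum of c ∷ xs ++ y ∷ ys.
maximaDescend-remove : ∀ c (xs : List ℕ) {y x ys} → MaximaDescend c (xs ++ y ∷ x ∷ ys) → x < y →
  ¬ (foldl _⊔_ c xs < y × StartsAbove y ys) → MaximaDescend c (xs ++ y ∷ ys)
maximaDescend-remove c [] {y} {x} {ys} (_ , _ , desc) x<y ¬rise =
  ¬rise , subst (λ d → MaximaDescend d ys) (m≥n⇒m⊔n≡m (≤-trans (<⇒≤ x<y) (m≤n⊔m c y))) desc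
maximaDescend-remove c (z ∷ xs) (¬rise , desc) x<y ¬rise′ =
  (λ (c<z , rise) → ¬rise (c<z , startsAbove-++ xs rise)) , maximaDescend-remove (c ⊔ z) xs desc x<y ¬rise′

maximaDescend-removePair : ∀ c (xs : List ℕ) {y x ys} → MaximaDescend c (xs ++ y ∷ x ∷ ys) → x < y →
  foldl _⊔_ c xs < y → StartsAbove y ys → MaximaDescend c (xs ++ ys)
maximaDescend-removePair c [] {y} {x} {ys} (_ , _ , desc) x<y c<y rise =
  maximaDescend-lower ys
    (subst (λ d → MaximaDescend d ys) (trans (m≥n⇒m⊔n≡m (≤-trans (<⇒≤ x<y) (m≤n⊔m c y))) (m≤n⇒m⊔n≡n (<⇒≤ c<y))) desc)
    rise (<⇒≤ c<y)
maximaDescend-removePair c (z ∷ []) (¬rise , desc) x<y c⊔z<y rise =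
  (λ (c<z , _) → ¬rise (c<z , m⊔n<o⇒n<o c z c⊔z<y)) , maximaDescend-removePair (c ⊔ z) [] desc x<y c⊔z<y rise
maximaDescend-removePair c (z ∷ w ∷ xs) (¬rise , desc) x<y h rise =
  ¬rise , maximaDescend-removePair (c ⊔ z) (w ∷ xs) desc x<y h rise

delete : ℕ → List ℕ → List ℕ
delete x [] = []
delete x (y ∷ ys) = if y ≡ᵇ x then ys else y ∷ delete x ys

delete-head : ∀ x ys → delete x (x ∷ ys) ≡ ys
delete-head x ys rewrite ≡ᵇ-refl x = refl

delete-∷ : ∀ {x y} ys → y ≢ x → delete x (y ∷ ys) ≡ y ∷ delete x ys
delete-∷ ys y≢x rewrite ≢⇒≡ᵇ≡false y≢x = refl

-- Junk value 0 when no entry precedes an occurrence of x.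
entryBefore : ℕ → List ℕ → ℕ
entryBefore x [] = 0
entryBefore x (a ∷ []) = 0
entryBefore x (a ∷ b ∷ ys) = if b ≡ᵇ x then a else entryBefore x (b ∷ ys)

entryBefore-hit : ∀ x a ys → entryBefore x (a ∷ x ∷ ys) ≡ a
entryBefore-hit x a ys rewrite ≡ᵇ-refl x = refl

entryBefore-∷ : ∀ {x a b} ys → b ≢ x → entryBefore x (a ∷ b ∷ ys) ≡ entryBefore x (b ∷ ys)
entryBefore-∷ ys b≢x rewrite ≢⇒≡ᵇ≡false b≢x = refl

insertAfterEach : ℕ → List ℕ → List (List ℕ)
insertAfterEach x [] = []
insertAfterEach x (y ∷ ys) = (y ∷ x ∷ ys) ∷ map (y ∷_) (insertAfterEach x ys)

insertAfterEach-head : ∀ {x w} ws {r} → r ∈ insertAfterEach x (w ∷ ws) → ∃[ t ] r ≡ w ∷ t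
insertAfterEach-head ws (here refl) = _ , refl
insertAfterEach-head ws (there r∈) with ∈-map⁻ _ r∈
... | r′ , _ , refl = r′ , refl

insertAfterEach-↭ : ∀ {x} (ρ : List ℕ) {r} → r ∈ insertAfterEach x ρ → r ↭ x ∷ ρ
insertAfterEach-↭ (y ∷ ys) (here refl) = swap y _ ↭-refl
insertAfterEach-↭ (y ∷ ys) (there r∈) with ∈-map⁻ _ r∈
... | r′ , r′∈ , refl = ↭-trans (prep y (insertAfterEach-↭ ys r′∈)) (swap y _ ↭-refl)

∈-insertAfterEach : ∀ {x} (xs : List ℕ) y ys → xs ++ y ∷ x ∷ ys ∈ insertAfterEach x (xs ++ y ∷ ys)
∈-insertAfterEach [] y ys = here refl
∈-insertAfterEach (z ∷ xs) y ys = there (∈-map⁺ (z ∷_) (∈-insertAfterEach xs y ys))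

delete-insertAfterEach : ∀ {x} (ρ : List ℕ) {r} → r ∈ insertAfterEach x ρ → All (x <_) ρ → delete x r ≡ ρ
delete-insertAfterEach {x} (y ∷ ys) (here refl) (x<y ∷ _) = trans (delete-∷ (x ∷ ys) (>⇒≢ x<y)) (cong (y ∷_) (delete-head x ys))
delete-insertAfterEach {x} (y ∷ ys) (there r∈) (x<y ∷ ρ>x) with ∈-map⁻ _ r∈
... | r′ , r′∈ , refl = trans (delete-∷ r′ (>⇒≢ x<y)) (cong (y ∷_) (delete-insertAfterEach ys r′∈ ρ>x))

length-insertAfterEach : ∀ x (ρ : List ℕ) → length (insertAfterEach x ρ) ≡ length ρ
length-insertAfterEach x [] = refl
length-insertAfterEach x (y ∷ ys) = cong suc (trans (length-map (y ∷_) (insertAfterEach x ys)) (length-insertAfterEach x ys))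

insertAfterEach-unique : ∀ {x} (ρ : List ℕ) → All (x <_) ρ → Unique (insertAfterEach x ρ)
insertAfterEach-unique [] _ = []
insertAfterEach-unique {x} (y ∷ ys) (_ ∷ ys>x) =
  Allₚ.map⁺ (All.tabulate (λ r∈ eq → x∷ys∉ ys ys>x r∈ (∷-injectiveʳ eq))) ∷
  Uniqueₚ.map⁺ ∷-injectiveʳ (insertAfterEach-unique ys ys>x)
  where
  x∷ys∉ : ∀ zs → All (x <_) zs → ∀ {r} → r ∈ insertAfterEach x zs → x ∷ zs ≢ r
  x∷ys∉ (w ∷ ws) (x<w ∷ _) r∈ eq with insertAfterEach-head ws r∈
  ... | t , refl = <-irrefl (∷-injectiveˡ eq) x<w

insertAfterEach-descend : ∀ {x} c (ρ : List ℕ) {r} → r ∈ insertAfterEach x ρ → All (x <_) ρ →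
                          MaximaDescend c ρ → MaximaDescend c r
insertAfterEach-descend {x} c (y ∷ ys) (here refl) (x<y ∷ _) (_ , desc) =
  (λ (_ , y<x) → <-asym x<y y<x) ,
  (λ (c⊔y<x , _) → <-asym x<y (m⊔n<o⇒n<o c y c⊔y<x)) ,
  subst (λ d → MaximaDescend d ys) (sym (m≥n⇒m⊔n≡m (≤-trans (<⇒≤ x<y) (m≤n⊔m c y)))) desc
insertAfterEach-descend {x} c (y ∷ ys) (there r∈) (x<y ∷ ys>x) (¬rise , desc) with ∈-map⁻ _ r∈
insertAfterEach-descend {x} c (y ∷ []) (there r∈) _ _ | _ , () , _
insertAfterEach-descend {x} c (y ∷ w ∷ ws) (there r∈) (x<y ∷ ys>x) (¬rise , desc) | r′ , r′∈ , refl
  with insertAfterEach-head ws r′∈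
... | t , refl = ¬rise , insertAfterEach-descend (c ⊔ y) (w ∷ ws) r′∈ ys>x desc

insertBlock : ℕ → List ℕ → List ℕ → List ℕ
insertBlock v bs [] = v ∷ bs
insertBlock v bs (y ∷ ys) = if v <ᵇ y then v ∷ bs ++ y ∷ ys else y ∷ insertBlock v bs ys

insertBlock-< : ∀ {v bs y} ys → v < y → insertBlock v bs (y ∷ ys) ≡ v ∷ bs ++ y ∷ ys
insertBlock-< ys v<y rewrite <ᵇ≡true v<y = refl

insertBlock-≮ : ∀ {v bs y} ys → ¬ v < y → insertBlock v bs (y ∷ ys) ≡ y ∷ insertBlock v bs ys
insertBlock-≮ ys v≮y rewrite <ᵇ≡false v≮y = refl

insertBlock-↭ : ∀ v bs (ρ : List ℕ) → insertBlock v bs ρ ↭ v ∷ bs ++ ρ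
insertBlock-↭ v bs [] = ↭-reflexive (cong (v ∷_) (sym (++-identityʳ bs)))
insertBlock-↭ v bs (y ∷ ys) with v <ᵇ y
... | true = ↭-refl
... | false = ↭-trans (prep y (insertBlock-↭ v bs ys)) (↭-sym (shift y (v ∷ bs) ys))

insertBlock-++ : ∀ {y} bs (xs : List ℕ) ys → All (_< y) xs → StartsAbove y ys →
                 insertBlock y bs (xs ++ ys) ≡ xs ++ y ∷ bs ++ ys
insertBlock-++ bs [] [] [] _ = cong (_ ∷_) (sym (++-identityʳ bs))
insertBlock-++ bs [] (z ∷ zs) [] y<z = insertBlock-< zs y<z
insertBlock-++ bs (x ∷ xs) ys (x<y ∷ xs<y) rise =
  trans (insertBlock-≮ (xs ++ ys) (<⇒≯ x<y)) (cong (x ∷_) (insertBlock-++ bs xs ys xs<y rise))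

startsAbove-insertBlock⁻ : ∀ {y v bs} (ys : List ℕ) → StartsAbove y (insertBlock v bs ys) → StartsAbove y ys
startsAbove-insertBlock⁻ [] _ = tt
startsAbove-insertBlock⁻ {y} {v} {bs} (w ∷ ws) rise with v <? w
... | yes v<w = <-trans (subst (StartsAbove y) (insertBlock-< ws v<w) rise) v<w
... | no v≮w = subst (StartsAbove y) (insertBlock-≮ ws v≮w) rise

startsAbove-insertBlock⁺ : ∀ {x v bs} (ρ : List ℕ) → x < v → All (x <_) ρ → StartsAbove x (insertBlock v bs ρ)
startsAbove-insertBlock⁺ [] x<v _ = x<v
startsAbove-insertBlock⁺ {x} {v} {bs} (y ∷ ys) x<v (x<y ∷ _) with v <? y
... | yes v<y = subst (StartsAbove x) (sym (insertBlock-< ys v<y)) x<v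
... | no v≮y = subst (StartsAbove x) (sym (insertBlock-≮ ys v≮y)) x<y

entryBefore-startsAbove : ∀ {x} a (ys : List ℕ) → StartsAbove x ys → entryBefore x (a ∷ ys) ≡ entryBefore x ys
entryBefore-startsAbove a [] _ = refl
entryBefore-startsAbove a (b ∷ ys) x<b = entryBefore-∷ ys (>⇒≢ x<b)

entryBefore-insertBlock : ∀ {v x} (ρ : List ℕ) → x < v → All (x <_) ρ → entryBefore x (insertBlock v (x ∷ []) ρ) ≡ v
entryBefore-insertBlock {v} {x} [] x<v _ = entryBefore-hit x v []
entryBefore-insertBlock {v} {x} (y ∷ ys) x<v (x<y ∷ ys>x) with v <? y
... | yes v<y = trans (cong (entryBefore x) (insertBlock-< ys v<y)) (entryBefore-hit x v (y ∷ ys))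
... | no v≮y = begin
  entryBefore x (insertBlock v (x ∷ []) (y ∷ ys))  ≡⟨ cong (entryBefore x) (insertBlock-≮ ys v≮y) ⟩
  entryBefore x (y ∷ insertBlock v (x ∷ []) ys)   ≡⟨ entryBefore-startsAbove y _ (startsAbove-insertBlock⁺ ys x<v ys>x) ⟩
  entryBefore x (insertBlock v (x ∷ []) ys)       ≡⟨ entryBefore-insertBlock ys x<v ys>x ⟩
  v                                              ∎
  where open ≡-Reasoning

delete-insertBlock : ∀ {v x} bs (ρ : List ℕ) → x < v → All (x <_) ρ →
                     delete x (insertBlock v (x ∷ bs) ρ) ≡ insertBlock v bs ρ
delete-insertBlock {v} {x} bs [] x<v _ = trans (delete-∷ (x ∷ bs) (>⇒≢ x<v)) (cong (v ∷_) (delete-head x bs))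
delete-insertBlock {v} {x} bs (y ∷ ys) x<v (x<y ∷ ys>x) with v <? y
... | yes v<y = begin
  delete x (insertBlock v (x ∷ bs) (y ∷ ys))  ≡⟨ cong (delete x) (insertBlock-< ys v<y) ⟩
  delete x (v ∷ x ∷ bs ++ y ∷ ys)             ≡⟨ delete-∷ (x ∷ bs ++ y ∷ ys) (>⇒≢ x<v) ⟩
  v ∷ delete x (x ∷ bs ++ y ∷ ys)             ≡⟨ cong (v ∷_) (delete-head x (bs ++ y ∷ ys)) ⟩
  v ∷ bs ++ y ∷ ys                            ≡⟨ insertBlock-< ys v<y ⟨
  insertBlock v bs (y ∷ ys)                   ∎
  where open ≡-Reasoning
... | no v≮y = begin
  delete x (insertBlock v (x ∷ bs) (y ∷ ys))  ≡⟨ cong (delete x) (insertBlock-≮ ys v≮y) ⟩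
  delete x (y ∷ insertBlock v (x ∷ bs) ys)    ≡⟨ delete-∷ (insertBlock v (x ∷ bs) ys) (>⇒≢ x<y) ⟩
  y ∷ delete x (insertBlock v (x ∷ bs) ys)    ≡⟨ cong (y ∷_) (delete-insertBlock bs ys x<v ys>x) ⟩
  y ∷ insertBlock v bs ys                     ≡⟨ insertBlock-≮ ys v≮y ⟨
  insertBlock v bs (y ∷ ys)                   ∎
  where open ≡-Reasoning

delete-insertBlock-[] : ∀ {v} (ρ : List ℕ) → All (_≢ v) ρ → delete v (insertBlock v [] ρ) ≡ ρ
delete-insertBlock-[] {v} [] _ = delete-head v []
delete-insertBlock-[] {v} (y ∷ ys) (y≢v ∷ ys≢v) with v <? y
... | yes v<y = trans (cong (delete v) (insertBlock-< ys v<y)) (delete-head v (y ∷ ys))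
... | no v≮y = trans (cong (delete v) (insertBlock-≮ ys v≮y))
                 (trans (delete-∷ (insertBlock v [] ys) y≢v) (cong (y ∷_) (delete-insertBlock-[] ys ys≢v)))

insertBlock-[]-¬descend : ∀ {v} c (ρ : List ℕ) → c < v → All (_≢ v) ρ → ¬ MaximaDescend c (insertBlock v [] ρ)
insertBlock-[]-¬descend c [] c<v _ (¬rise , _) = ¬rise (c<v , tt)
insertBlock-[]-¬descend {v} c (y ∷ ys) c<v (y≢v ∷ ys≢v) desc with v <? y
... | yes v<y = proj₁ (subst (MaximaDescend c) (insertBlock-< ys v<y) desc) (c<v , v<y)
... | no v≮y = insertBlock-[]-¬descend (c ⊔ y) ys (⊔-lub c<v (≤∧≢⇒< (≮⇒≥ v≮y) y≢v)) ys≢v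
                 (proj₂ (subst (MaximaDescend c) (insertBlock-≮ ys v≮y) desc))

insertBlock-descend : ∀ {v x} c (ρ : List ℕ) → x < v → MaximaDescend c ρ → MaximaDescend c (insertBlock v (x ∷ []) ρ)
insertBlock-descend {v} {x} c [] x<v _ =
  (λ (_ , v<x) → <-asym x<v v<x) , (λ (c⊔v<x , _) → <-asym x<v (m⊔n<o⇒n<o c v c⊔v<x)) , tt
insertBlock-descend {v} {x} c (y ∷ ys) x<v (¬rise , desc) with v <? y
... | yes v<y = subst (MaximaDescend c) (sym (insertBlock-< ys v<y))
  ( (λ (_ , v<x) → <-asym x<v v<x)
  , (λ (c⊔v<x , _) → <-asym x<v (m⊔n<o⇒n<o c v c⊔v<x))
  , subst (λ d → MaximaDescend d (y ∷ ys)) (sym (m≥n⇒m⊔n≡m (≤-trans (<⇒≤ x<v) (m≤n⊔m c v))))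
      ( (λ (c⊔v<y , rise) → ¬rise (m⊔n<o⇒m<o c v c⊔v<y , rise))
      , subst (λ d → MaximaDescend d ys) (sym c⊔v⊔y≡c⊔y) desc))
  where
  c⊔v⊔y≡c⊔y : (c ⊔ v) ⊔ y ≡ c ⊔ y
  c⊔v⊔y≡c⊔y = trans (⊔-assoc c v y) (cong (c ⊔_) (m≤n⇒m⊔n≡n (<⇒≤ v<y)))
... | no v≮y = subst (MaximaDescend c) (sym (insertBlock-≮ ys v≮y))
  ( (λ (c<y , rise) → ¬rise (c<y , startsAbove-insertBlock⁻ ys rise))
  , insertBlock-descend (c ⊔ y) ys x<v desc)

module _ {A : Set} where

  removals : List A → List (A × List A)
  removals [] = []
  removals (v ∷ vs) = (v , vs) ∷ map (map₂ (v ∷_)) (removals vs)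

  ∈-removals⁻ : ∀ (xs : List A) {v r} → (v , r) ∈ removals xs → ∃[ ys ] ∃[ zs ] xs ≡ ys ++ v ∷ zs × r ≡ ys ++ zs
  ∈-removals⁻ (w ∷ ws) (here refl) = [] , ws , refl , refl
  ∈-removals⁻ (w ∷ ws) (there p∈) with ∈-map⁻ _ p∈
  ... | _ , p∈′ , refl with ∈-removals⁻ ws p∈′
  ...   | ys , zs , refl , refl = w ∷ ys , zs , refl , refl

  ∈-removals⁺ : ∀ (ys : List A) v zs → (v , ys ++ zs) ∈ removals (ys ++ v ∷ zs)
  ∈-removals⁺ [] v zs = here refl
  ∈-removals⁺ (y ∷ ys) v zs = there (∈-map⁺ (map₂ (y ∷_)) (∈-removals⁺ ys v zs))

  map-proj₁-removals : ∀ (xs : List A) → map proj₁ (removals xs) ≡ xs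
  map-proj₁-removals [] = refl
  map-proj₁-removals (v ∷ vs) = cong (v ∷_) (trans (sym (map-∘ (removals vs))) (map-proj₁-removals vs))

  All-drop-mid : ∀ {P : A → Set} xs {v ys} → All P (xs ++ v ∷ ys) → All P (xs ++ ys)
  All-drop-mid [] (_ ∷ pys) = pys
  All-drop-mid (_ ∷ xs) (px ∷ pxs) = px ∷ All-drop-mid xs pxs

  AllPairs-split : ∀ {R : A → A → Set} xs {v ys} → AllPairs R (xs ++ v ∷ ys) → All (λ x → R x v) xs × All (R v) ys
  AllPairs-split [] (rys ∷ _) = [] , rys
  AllPairs-split (_ ∷ xs) (rx ∷ rxs) with AllPairs-split xs rxs
  ... | rxs-v , rv-ys = All.lookup rx (∈-++⁺ʳ xs (here refl)) ∷ rxs-v , rv-ys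

  AllPairs-drop-mid : ∀ {R : A → A → Set} xs {v ys} → AllPairs R (xs ++ v ∷ ys) → AllPairs R (xs ++ ys)
  AllPairs-drop-mid [] (_ ∷ rys) = rys
  AllPairs-drop-mid (_ ∷ xs) (rx ∷ rxs) = All-drop-mid xs rx ∷ AllPairs-drop-mid xs rxs

module _ {A B : Set} where

  ∈-concatMap-intro : ∀ {f : A → List B} {as a b} → a ∈ as → b ∈ f a → b ∈ concatMap f as
  ∈-concatMap-intro {f} a∈ b∈ = ∈-concatMap⁺ f (lose a∈ b∈)

  ∈-concatMap-elim : ∀ {f : A → List B} as {b} → b ∈ concatMap f as → ∃[ a ] a ∈ as × b ∈ f a
  ∈-concatMap-elim {f} as b∈ = find (∈-concatMap⁻ f b∈)

  length-concatMap-const : ∀ {f : A → List B} as k → (∀ {a} → a ∈ as → length (f a) ≡ k) →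
                           length (concatMap f as) ≡ length as * k
  length-concatMap-const [] k _ = refl
  length-concatMap-const {f} (a ∷ as) k len =
    trans (length-++ (f a)) (cong₂ _+_ (len (here refl)) (length-concatMap-const as k (len ∘ there)))

  unique-map-retraction : ∀ (f : A → B) (g : B → A) as → (∀ {a} → a ∈ as → g (f a) ≡ a) → Unique as → Unique (map f as)
  unique-map-retraction f g [] _ [] = []
  unique-map-retraction f g (a ∷ as) gf≡ (a∉ ∷ u) =
    Allₚ.map⁺ (All.tabulate (λ {a′} a′∈ fa≡fa′ →
      All.lookup a∉ a′∈ (trans (sym (gf≡ (here refl))) (trans (cong g fa≡fa′) (gf≡ (there a′∈))))))
    ∷ unique-map-retraction f g as (gf≡ ∘ there) u

  unique-concatMap : ∀ {K : Set} (f : A → List B) (key : A → K) (g : B → K) as →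
    Unique (map key as) → (∀ {a} → a ∈ as → Unique (f a)) → (∀ {a b} → a ∈ as → b ∈ f a → g b ≡ key a) →
    Unique (concatMap f as)
  unique-concatMap f key g [] _ _ _ = []
  unique-concatMap f key g (a ∷ as) (key∉ ∷ u) uf g≡ =
    Uniqueₚ.++⁺ (uf (here refl)) (unique-concatMap f key g as u (uf ∘ there) (g≡ ∘ there)) disjoint
    where
    disjoint : ∀ {b} → ¬ (b ∈ f a × b ∈ concatMap f as)
    disjoint (b∈fa , b∈rest) with ∈-concatMap-elim as b∈rest
    ... | a′ , a′∈ , b∈fa′ = All.lookup key∉ (∈-map⁺ key a′∈) (trans (sym (g≡ (here refl) b∈fa)) (g≡ (there a′∈) b∈fa′))

insertBlocks : ℕ → (List ℕ → List (List ℕ)) → ℕ × List ℕ → List (List ℕ)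
insertBlocks x arrange (v , rest) = map (insertBlock v (x ∷ [])) (arrange rest)

-- For sorted X and fuel k ≥ length X: the arrangements of X whose maxima descend, built by
-- inserting the least entry x alone, or together with the maximum v that it follows.
arrangements : ℕ → List ℕ → List (List ℕ)
arrangements _ [] = [] ∷ []
arrangements zero (_ ∷ _) = []
arrangements (suc k) (x ∷ xs) =
  concatMap (insertAfterEach x) (arrangements k xs) ++ concatMap (insertBlocks x (arrangements k)) (removals xs)

arrangements-sound : ∀ k X → AllPairs _<_ X → ∀ {ρ} → ρ ∈ arrangements k X → ρ ↭ X × MaximaDescend 0 ρ
arrangements-sound _ [] _ (here refl) = ↭-refl , tt
arrangements-sound (suc k) (x ∷ xs) (x<xs ∷ xs↑) ρ∈ with ∈-++⁻ (concatMap (insertAfterEach x) (arrangements k xs)) ρ∈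
... | inj₁ ρ∈A with ∈-concatMap-elim (arrangements k xs) ρ∈A
...   | ρ′ , ρ′∈ , ρ∈ins with arrangements-sound k xs xs↑ ρ′∈
...     | ρ′↭ , desc = ↭-trans (insertAfterEach-↭ ρ′ ρ∈ins) (prep x ρ′↭) ,
                       insertAfterEach-descend 0 ρ′ ρ∈ins (All-resp-↭ (↭-sym ρ′↭) x<xs) desc
arrangements-sound (suc k) (x ∷ xs) (x<xs ∷ xs↑) ρ∈ | inj₂ ρ∈B with ∈-concatMap-elim (removals xs) ρ∈B
... | (v , _) , p∈ , ρ∈map with ∈-map⁻ _ ρ∈map | ∈-removals⁻ xs p∈
...   | ρ″ , ρ″∈ , refl | ys , zs , refl , refl with arrangements-sound k (ys ++ zs) (AllPairs-drop-mid ys xs↑) ρ″∈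
...     | ρ″↭ , desc = ρ↭ , insertBlock-descend 0 ρ″ x<v desc
  where
  x<v : x < v
  x<v = All.lookup x<xs (∈-++⁺ʳ ys (here refl))
  ρ↭ : insertBlock v (x ∷ []) ρ″ ↭ x ∷ ys ++ v ∷ zs
  ρ↭ = ↭-trans (insertBlock-↭ v (x ∷ []) ρ″) (↭-trans (swap v x ↭-refl) (prep x (↭-trans (prep v ρ″↭) (↭-sym (shift v ys zs)))))

arrangements-removal : ∀ k {x xs} → AllPairs _<_ (x ∷ xs) → ∀ {v rest} → (v , rest) ∈ removals xs →
  AllPairs _<_ rest × (∀ {ρ} → ρ ∈ arrangements k rest → x < v × All (x <_) ρ × All (_≢ v) ρ)
arrangements-removal k {x} {xs} (x<xs ∷ xs↑) {v} p∈ with ∈-removals⁻ xs p∈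
... | ys , zs , refl , refl = rest↑ , facts
  where
  rest↑ : AllPairs _<_ (ys ++ zs)
  rest↑ = AllPairs-drop-mid ys xs↑
  facts : ∀ {ρ} → ρ ∈ arrangements k (ys ++ zs) → x < v × All (x <_) ρ × All (_≢ v) ρ
  facts {ρ} ρ∈ with AllPairs-split ys xs↑
  ... | ys<v , v<zs = All.lookup x<xs (∈-++⁺ʳ ys (here refl)) ,
                      All-resp-↭ (↭-sym ρ↭) (All-drop-mid ys x<xs) ,
                      All-resp-↭ (↭-sym ρ↭) (Allₚ.++⁺ (All.map <⇒≢ ys<v) (All.map >⇒≢ v<zs))
    where
    ρ↭ : ρ ↭ ys ++ zs
    ρ↭ = proj₁ (arrangements-sound k (ys ++ zs) rest↑ ρ∈)

∈-arrangements-after : ∀ k x xs α y β → α ++ y ∷ β ∈ arrangements k xs → α ++ y ∷ x ∷ β ∈ arrangements (suc k) (x ∷ xs)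
∈-arrangements-after k x xs α y β ρ∈ = ∈-++⁺ˡ (∈-concatMap-intro ρ∈ (∈-insertAfterEach α y β))

∈-arrangements-block : ∀ k x ys y zs α β → All (_< y) α → StartsAbove y β → α ++ β ∈ arrangements k (ys ++ zs) →
                       α ++ y ∷ x ∷ β ∈ arrangements (suc k) (x ∷ ys ++ y ∷ zs)
∈-arrangements-block k x ys y zs α β α<y rise ρ∈ =
  ∈-++⁺ʳ (concatMap (insertAfterEach x) (arrangements k (ys ++ y ∷ zs)))
    (∈-concatMap-intro (∈-removals⁺ ys y zs)
      (subst (_∈ map (insertBlock y (x ∷ [])) (arrangements k (ys ++ zs))) (insertBlock-++ (x ∷ []) α β α<y rise)
        (∈-map⁺ (insertBlock y (x ∷ [])) ρ∈)))

arrangements-complete : ∀ k X → length X ≤ k → AllPairs _<_ X → All (0 <_) X →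
                        ∀ {ρ} → ρ ↭ X → MaximaDescend 0 ρ → ρ ∈ arrangements k X
arrangements-complete _ [] _ _ _ ρ↭ _ rewrite ↭-empty-inv ρ↭ = here refl
arrangements-complete (suc k) (x ∷ xs) (s≤s len) (x<xs ∷ xs↑) (0<x ∷ xs>0) {ρ} ρ↭ desc
  with ∈-∃++ (∈-resp-↭ (↭-sym ρ↭) (here refl))
... | α , β , refl with initLast α
...   | [] = contradiction (0<x , head-above β (drop-∷ ρ↭)) (proj₁ desc)
  where
  head-above : ∀ β → β ↭ xs → StartsAbove x β
  head-above [] _ = tt
  head-above (b ∷ _) β↭ = All.lookup x<xs (∈-resp-↭ β↭ (here refl))
...   | α′ ∷ʳ′ y = subst (_∈ arrangements (suc k) (x ∷ xs)) (sym ρ≡) ρ′∈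
  where
  ρ≡ : (α′ ∷ʳ y) ++ x ∷ β ≡ α′ ++ y ∷ x ∷ β
  ρ≡ = ++-assoc α′ (y ∷ []) (x ∷ β)
  ρ′↭ : α′ ++ y ∷ x ∷ β ↭ x ∷ xs
  ρ′↭ = subst (_↭ x ∷ xs) ρ≡ ρ↭
  desc′ : MaximaDescend 0 (α′ ++ y ∷ x ∷ β)
  desc′ = subst (MaximaDescend 0) ρ≡ desc
  rest↭ : α′ ++ y ∷ β ↭ xs
  rest↭ = drop-∷ (↭-trans (↭-sym (shift x α′ (y ∷ β))) (↭-trans (++⁺ˡ α′ (swap x y ↭-refl)) ρ′↭))
  y∈xs : y ∈ xs
  y∈xs = ∈-resp-↭ rest↭ (∈-++⁺ʳ α′ (here refl))
  x<y : x < y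
  x<y = All.lookup x<xs y∈xs
  ρ′∈ : α′ ++ y ∷ x ∷ β ∈ arrangements (suc k) (x ∷ xs)
  ρ′∈ with (foldl _⊔_ 0 α′ <? y) ×-dec (startsAbove? y β)
  ... | no ¬maxRise = ∈-arrangements-after k x xs α′ y β
          (arrangements-complete k xs len xs↑ xs>0 rest↭ (maximaDescend-remove 0 α′ desc′ x<y ¬maxRise))
  ... | yes (max , rise) with ∈-∃++ y∈xs
  ...   | ys , zs , refl = ∈-arrangements-block k x ys y zs α′ β (foldl-⊔<⇒All< 0 α′ max) rise
          (arrangements-complete k (ys ++ zs) len′ (AllPairs-drop-mid ys xs↑) (All-drop-mid ys xs>0)
            (drop-mid α′ ys rest↭) (maximaDescend-removePair 0 α′ desc′ x<y max rise))
    where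
    len′ : length (ys ++ zs) ≤ k
    len′ = ≤-trans (n≤1+n _) (subst (_≤ k) (length-++-sucʳ ys y zs) len)

-- Deleting x from an arrangement of the first part leaves one whose maxima descend; from one of
-- the second part it leaves insertBlock v [] ρ, where the maximum v is followed by a rise.
arrangements-parts-disjoint : ∀ k {x xs} → AllPairs _<_ (x ∷ xs) → ∀ {r} →
  r ∈ concatMap (insertAfterEach x) (arrangements k xs) → r ∉ concatMap (insertBlocks x (arrangements k)) (removals xs)
arrangements-parts-disjoint k {x} {xs} X↑@(x<xs ∷ xs↑) r∈after r∈blocks
  with ∈-concatMap-elim (arrangements k xs) r∈after | ∈-concatMap-elim (removals xs) r∈blocks
... | ρ′ , ρ′∈ , r∈ins | (v , rest) , p∈ , r∈map with ∈-map⁻ _ r∈map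
...   | ρ , ρ∈ , refl with proj₂ (arrangements-removal k X↑ p∈) ρ∈
...     | x<v , ρ>x , ρ≢v = insertBlock-[]-¬descend 0 ρ (≤-<-trans z≤n x<v) ρ≢v
  (subst (MaximaDescend 0) (trans (sym (delete-insertAfterEach ρ′ r∈ins ρ′>x)) (delete-insertBlock [] ρ x<v ρ>x))
    (proj₂ (arrangements-sound k xs xs↑ ρ′∈)))
  where
  ρ′>x : All (x <_) ρ′
  ρ′>x = All-resp-↭ (↭-sym (proj₁ (arrangements-sound k xs xs↑ ρ′∈))) x<xs

arrangements-unique : ∀ k X → AllPairs _<_ X → Unique (arrangements k X)
arrangements-unique _ [] _ = [] ∷ []
arrangements-unique zero (_ ∷ _) _ = []
arrangements-unique (suc k) (x ∷ xs) X↑@(x<xs ∷ xs↑) =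
  Uniqueₚ.++⁺ unique-after unique-blocks (λ (r∈after , r∈blocks) → arrangements-parts-disjoint k X↑ r∈after r∈blocks)
  where
  ρ>x : ∀ {ρ} → ρ ∈ arrangements k xs → All (x <_) ρ
  ρ>x ρ∈ = All-resp-↭ (↭-sym (proj₁ (arrangements-sound k xs xs↑ ρ∈))) x<xs
  unique-after : Unique (concatMap (insertAfterEach x) (arrangements k xs))
  unique-after = unique-concatMap (insertAfterEach x) id (delete x) (arrangements k xs)
    (subst Unique (sym (map-id _)) (arrangements-unique k xs xs↑))
    (λ ρ∈ → insertAfterEach-unique _ (ρ>x ρ∈))
    (λ ρ∈ r∈ → delete-insertAfterEach _ r∈ (ρ>x ρ∈))
  unique-insertBlocks : ∀ {p} → p ∈ removals xs → Unique (insertBlocks x (arrangements k) p)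
  unique-insertBlocks {v , rest} p∈ with arrangements-removal k X↑ p∈
  ... | rest↑ , facts = unique-map-retraction (insertBlock v (x ∷ [])) (delete v ∘ delete x) (arrangements k rest)
    (λ {ρ} ρ∈ → let (x<v , ρ>x , ρ≢v) = facts ρ∈ in
      trans (cong (delete v) (delete-insertBlock [] ρ x<v ρ>x)) (delete-insertBlock-[] ρ ρ≢v))
    (arrangements-unique k rest rest↑)
  entryBefore-insertBlocks : ∀ {p r} → p ∈ removals xs → r ∈ insertBlocks x (arrangements k) p → entryBefore x r ≡ proj₁ p
  entryBefore-insertBlocks {v , rest} p∈ r∈ with ∈-map⁻ _ r∈
  ... | ρ , ρ∈ , refl = let (x<v , ρ>x , _) = proj₂ (arrangements-removal k X↑ p∈) ρ∈ in
                        entryBefore-insertBlock ρ x<v ρ>x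
  unique-blocks : Unique (concatMap (insertBlocks x (arrangements k)) (removals xs))
  unique-blocks = unique-concatMap (insertBlocks x (arrangements k)) proj₁ (entryBefore x) (removals xs)
    (subst Unique (sym (map-proj₁-removals xs)) (sorted⇒unique xs↑)) unique-insertBlocks entryBefore-insertBlocks

derangements : ℕ → ℕ
derangements 0 = 1
derangements 1 = 0
derangements (suc (suc m)) = derangements (suc m) * suc m + suc m * derangements m

derangements-suc : ∀ m → derangements (suc m) ≡ derangements m * m + m * derangements (pred m)
derangements-suc zero = refl
derangements-suc (suc m) = refl

length-arrangements : ∀ k X → length X ≤ k → AllPairs _<_ X → length (arrangements k X) ≡ derangements (length X)
length-arrangements _ [] _ _ = refl
length-arrangements (suc k) (x ∷ xs) (s≤s len) (_ ∷ xs↑) = begin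
  length (after ++ blocks)                                      ≡⟨ length-++ after ⟩
  length after + length blocks                                  ≡⟨ cong₂ _+_ length-after length-blocks ⟩
  derangements (length xs) * length xs + length xs * derangements (pred (length xs))
                                                                ≡⟨ derangements-suc (length xs) ⟨
  derangements (suc (length xs))                                ∎
  where
  open ≡-Reasoning
  after blocks : List (List ℕ)
  after = concatMap (insertAfterEach x) (arrangements k xs)
  blocks = concatMap (insertBlocks x (arrangements k)) (removals xs)
  length-after : length after ≡ derangements (length xs) * length xs
  length-after = trans
    (length-concatMap-const (arrangements k xs) (length xs)
      (λ {ρ} ρ∈ → trans (length-insertAfterEach x ρ) (↭-length (proj₁ (arrangements-sound k xs xs↑ ρ∈)))))
    (cong (_* length xs) (length-arrangements k xs len xs↑))
  length-block : ∀ {p} → p ∈ removals xs → length (insertBlocks x (arrangements k) p) ≡ derangements (pred (length xs))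
  length-block {v , rest} p∈ with ∈-removals⁻ xs p∈
  ... | ys , zs , refl , refl = begin
    length (insertBlocks x (arrangements k) (v , ys ++ zs))  ≡⟨ length-map _ (arrangements k (ys ++ zs)) ⟩
    length (arrangements k (ys ++ zs))            ≡⟨ length-arrangements k (ys ++ zs) len′ (AllPairs-drop-mid ys xs↑) ⟩
    derangements (length (ys ++ zs))              ≡⟨ cong (derangements ∘ pred) (length-++-sucʳ ys v zs) ⟨
    derangements (pred (length (ys ++ v ∷ zs)))   ∎
    where
    len′ : length (ys ++ zs) ≤ k
    len′ = ≤-trans (n≤1+n _) (subst (_≤ k) (length-++-sucʳ ys v zs) len)
  length-removals : length (removals xs) ≡ length xs
  length-removals = trans (sym (length-map proj₁ (removals xs))) (cong length (map-proj₁-removals xs))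
  length-blocks : length blocks ≡ length xs * derangements (pred (length xs))
  length-blocks = trans (length-concatMap-const (removals xs) _ length-block)
                        (cong (_* derangements (pred (length xs))) length-removals)

-- Derangement numbers

subfactorial : ℕ → ℤ
subfactorial zero = 1ℤ
subfactorial (suc m) = + suc m ℤ.* subfactorial m ℤ.+ -1ℤ ℤ.^ suc m

derangements≡subfactorial : ∀ m → + derangements m ≡ subfactorial m
derangements≡subfactorial m = proj₁ (consecutive m)
  where
  open ≡-Reasoning
  recurrence : ∀ K D s → (K ℤ.* D ℤ.+ s) ℤ.* K ℤ.+ K ℤ.* D ≡ (1ℤ ℤ.+ K) ℤ.* (K ℤ.* D ℤ.+ s) ℤ.+ -1ℤ ℤ.* s
  recurrence = solve 3 (λ K D s → (K :* D :+ s) :* K :+ K :* D := (con 1ℤ :+ K) :* (K :* D :+ s) :+ con -1ℤ :* s) refl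
    where open +-*-Solver
  consecutive : ∀ m → + derangements m ≡ subfactorial m × + derangements (suc m) ≡ subfactorial (suc m)
  consecutive zero = refl , refl
  consecutive (suc m) with consecutive m
  ... | Dₘ≡ , Dₘ₊₁≡ = Dₘ₊₁≡ , (begin
    + derangements (suc (suc m))
      ≡⟨ ℤP.pos-+ (derangements (suc m) * suc m) (suc m * derangements m) ⟩
    + (derangements (suc m) * suc m) ℤ.+ + (suc m * derangements m)
      ≡⟨ cong₂ ℤ._+_ (ℤP.pos-* (derangements (suc m)) (suc m)) (ℤP.pos-* (suc m) (derangements m)) ⟩
    + derangements (suc m) ℤ.* + suc m ℤ.+ + suc m ℤ.* + derangements m
      ≡⟨ cong₂ (λ a b → a ℤ.* + suc m ℤ.+ + suc m ℤ.* b) Dₘ₊₁≡ Dₘ≡ ⟩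
    subfactorial (suc m) ℤ.* + suc m ℤ.+ + suc m ℤ.* subfactorial m
      ≡⟨ recurrence (+ suc m) (subfactorial m) (-1ℤ ℤ.^ suc m) ⟩
    subfactorial (suc (suc m)) ∎)

alternatingTerm : ℕ → ℚ
alternatingTerm i = ((-1ℤ ℤ.^ i) ℚ./ (i !)) {{i !≢0}}

toℚᵘ-/ : ∀ i k .{{_ : NonZero k}} → toℚᵘ (i / k) ≃ mkℚᵘ i (pred k)
toℚᵘ-/ i (suc k) = ℚP.toℚᵘ-fromℚᵘ (mkℚᵘ i k)

-- In ℚᵘ the denominator of mkℚᵘ a b is suc b, hence the pred (m !) below.
sum-alternatingTerm : ∀ m → toℚᵘ (sumQ (suc m) alternatingTerm) ≃ mkℚᵘ (subfactorial m) (pred (m !))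
sum-alternatingTerm zero = *≡* refl
sum-alternatingTerm (suc m) = ℚᵘP.≃-trans (ℚP.toℚᵘ-homo-+ (sumQ (suc m) alternatingTerm) (alternatingTerm (suc m)))
  (ℚᵘP.≃-trans (ℚᵘP.+-cong (sum-alternatingTerm m) (toℚᵘ-/ (-1ℤ ℤ.^ suc m) (suc m !) {{suc m !≢0}})) (*≡* cross))
  where
  open ≡-Reasoning
  D s K A : ℤ
  D = subfactorial m
  s = -1ℤ ℤ.^ suc m
  K = + suc m
  A = + (m !)
  A′ B′ : ℕ
  A′ = pred (m !)
  B′ = pred (suc m !)
  A≡ : + suc A′ ≡ A
  A≡ = cong +_ (suc-pred (m !) {{m !≢0}})
  B≡ : + suc B′ ≡ K ℤ.* A
  B≡ = trans (cong +_ (suc-pred (suc m !) {{suc m !≢0}})) (ℤP.pos-* (suc m) (m !))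
  identity : ∀ K A D s → (D ℤ.* (K ℤ.* A) ℤ.+ s ℤ.* A) ℤ.* (K ℤ.* A) ≡ (K ℤ.* D ℤ.+ s) ℤ.* (A ℤ.* (K ℤ.* A))
  identity = solve 4 (λ K A D s → (D :* (K :* A) :+ s :* A) :* (K :* A) := (K :* D :+ s) :* (A :* (K :* A))) refl
    where open +-*-Solver
  cross : (D ℤ.* + suc B′ ℤ.+ s ℤ.* + suc A′) ℤ.* + suc B′ ≡ (K ℤ.* D ℤ.+ s) ℤ.* + (suc A′ * suc B′)
  cross = begin
    (D ℤ.* + suc B′ ℤ.+ s ℤ.* + suc A′) ℤ.* + suc B′  ≡⟨ cong₂ (λ a b → (D ℤ.* b ℤ.+ s ℤ.* a) ℤ.* b) A≡ B≡ ⟩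
    (D ℤ.* (K ℤ.* A) ℤ.+ s ℤ.* A) ℤ.* (K ℤ.* A)      ≡⟨ identity K A D s ⟩
    (K ℤ.* D ℤ.+ s) ℤ.* (A ℤ.* (K ℤ.* A))            ≡⟨ cong ((K ℤ.* D ℤ.+ s) ℤ.*_) (cong₂ ℤ._*_ A≡ B≡) ⟨
    (K ℤ.* D ℤ.+ s) ℤ.* (+ suc A′ ℤ.* + suc B′)      ≡⟨ cong ((K ℤ.* D ℤ.+ s) ℤ.*_) (ℤP.pos-* (suc A′) (suc B′)) ⟨
    (K ℤ.* D ℤ.+ s) ℤ.* + (suc A′ * suc B′)          ∎

derangements≡derangementFormula : ∀ m → (+ derangements m) / 1 ≡ derangementFormula (suc m)
derangements≡derangementFormula m = ℚP.toℚᵘ-injective (begin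
  toℚᵘ ((+ derangements m) / 1)                                  ≈⟨ toℚᵘ-/ (+ derangements m) 1 ⟩
  mkℚᵘ (+ derangements m) 0                                      ≈⟨ *≡* cross ⟩
  mkℚᵘ (+ (m !)) 0 ℚᵘ.* mkℚᵘ (subfactorial m) (pred (m !))       ≈⟨ ℚᵘP.*-cong (toℚᵘ-/ (+ (m !)) 1) (sum-alternatingTerm m) ⟨
  toℚᵘ ((+ (m !)) / 1) ℚᵘ.* toℚᵘ (sumQ (suc m) alternatingTerm)  ≈⟨ ℚP.toℚᵘ-homo-* ((+ (m !)) / 1) (sumQ (suc m) alternatingTerm) ⟨
  toℚᵘ (derangementFormula (suc m))                              ∎)
  where
  open ℚᵘP.≃-Reasoning
  cross : + derangements m ℤ.* + (1 * suc (pred (m !))) ≡ (+ (m !) ℤ.* subfactorial m) ℤ.* + 1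
  cross = trans (cong₂ ℤ._*_ (derangements≡subfactorial m) (cong +_ (trans (*-identityˡ _) (suc-pred (m !) {{m !≢0}}))))
         (trans (ℤP.*-comm (subfactorial m) (+ (m !))) (sym (ℤP.*-identityʳ _)))

module _ (m : ℕ) where

  ∈-arrangements⇔ : ∀ ρ → ρ ∈ arrangements m (oneTo m) ⇔ (InS (suc m) (ρ ∷ʳ suc m) × ¬ AdjacentMaxima 0 (ρ ∷ʳ suc m))
  ∈-arrangements⇔ ρ = mk⇔
    (λ ρ∈ → let (ρ↭ , desc) = arrangements-sound m (oneTo m) (oneTo-sorted m) ρ∈ in
            ↭-trans (++⁺ʳ (suc m ∷ []) ρ↭) oneTo-∷ʳ↭ , maximaDescend⇒¬adjacentMaxima 0 ρ desc)
    (λ (ρn∈Sₙ , noAdj) →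
       arrangements-complete m (oneTo m) (≤-reflexive (length-applyUpTo suc m)) (oneTo-sorted m)
         (applyUpTo⁺₂ suc m (λ _ → z<s))
         (drop-∷ (↭-trans (∷↭∷ʳ (suc m) ρ) (↭-trans ρn∈Sₙ (↭-sym (↭-trans (∷↭∷ʳ (suc m) (oneTo m)) oneTo-∷ʳ↭)))))
         (¬adjacentMaxima⇒maximaDescend 0 ρ (proj₁ (InS-split-max ρ ρn∈Sₙ)) noAdj))
    where
    oneTo-∷ʳ↭ : oneTo m ∷ʳ suc m ↭ oneTo (suc m)
    oneTo-∷ʳ↭ = ↭-reflexive (applyUpTo-∷ʳ suc m)

  InQ1⇔∈arrangements : ∀ π → π ∈ map (_∷ʳ suc m) (arrangements m (oneTo m)) ⇔ InQ1 (suc m) π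
  InQ1⇔∈arrangements π = mk⇔ to from
    where
    to : π ∈ map (_∷ʳ suc m) (arrangements m (oneTo m)) → InQ1 (suc m) π
    to π∈ with ∈-map⁻ (_∷ʳ suc m) π∈
    ... | ρ , ρ∈ , refl = let (π∈Sₙ , noAdj) = Equivalence.to (∈-arrangements⇔ ρ) ρ∈ in
                          Equivalence.from (InQ1⇔ z<s π) (π∈Sₙ , last-∷ʳ ρ (suc m) , noAdj)
    from : InQ1 (suc m) π → π ∈ map (_∷ʳ suc m) (arrangements m (oneTo m))
    from π∈Q with Equivalence.to (InQ1⇔ z<s π) π∈Q
    ... | π∈Sₙ , last≡n , noAdj with last≡just⇒∷ʳ π last≡n
    ...   | ρ , refl = ∈-map⁺ (_∷ʳ suc m) (Equivalence.from (∈-arrangements⇔ ρ) (π∈Sₙ , noAdj))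

proposition4p7 : (n : ℕ) → 1 ≤ n →
    ((π : List ℕ) → InQ1 n π ⇔ (InS n π × last π ≡ just n × NoAdjacentLTRMax π))
    × Σ (List (List ℕ)) (λ L → Unique L × ((π : List ℕ) → π ∈ L ⇔ InQ1 n π)
        × (+ (length L)) / 1 ≡ derangementFormula n)
proposition4p7 (suc m) 1≤n = characterisation , Q₁ , unique , InQ1⇔∈arrangements m , count
  where
  Q₁ : List (List ℕ)
  Q₁ = map (_∷ʳ suc m) (arrangements m (oneTo m))
  characterisation : (π : List ℕ) → InQ1 (suc m) π ⇔ (InS (suc m) π × last π ≡ just (suc m) × NoAdjacentLTRMax π)
  characterisation π = mk⇔
    (λ π∈Q → let (π∈Sₙ , last≡n , noAdj) = Equivalence.to (InQ1⇔ 1≤n π) π∈Q in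
             π∈Sₙ , last≡n , Equivalence.from (noAdjacentLTRMax⇔ π (InS⇒positive π∈Sₙ)) noAdj)
    (λ (π∈Sₙ , last≡n , noLTR) →
       Equivalence.from (InQ1⇔ 1≤n π) (π∈Sₙ , last≡n , Equivalence.to (noAdjacentLTRMax⇔ π (InS⇒positive π∈Sₙ)) noLTR))
  unique : Unique Q₁
  unique = Uniqueₚ.map⁺ (∷ʳ-injectiveˡ _ _) (arrangements-unique m (oneTo m) (oneTo-sorted m))
  count : (+ (length Q₁)) / 1 ≡ derangementFormula (suc m)
  count = begin
    + length Q₁ / 1                              ≡⟨ cong (λ k → + k / 1) (length-map (_∷ʳ suc m) (arrangements m (oneTo m))) ⟩
    + length (arrangements m (oneTo m)) / 1       ≡⟨ cong (λ k → + k / 1) (length-arrangements m (oneTo m) (≤-reflexive (length-applyUpTo suc m)) (oneTo-sorted m)) ⟩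
    + derangements (length (oneTo m)) / 1         ≡⟨ cong (λ k → + derangements k / 1) (length-applyUpTo suc m) ⟩
    + derangements m / 1                          ≡⟨ derangements≡derangementFormula m ⟩
    derangementFormula (suc m)                    ∎
    where open ≡-Reasoning
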